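{- Let $i\ge 7$. The word $F_{i-3}$ occurs in $F_i$ exactly at the positions $1$, $f_{i-3}+1$, $f_{i-2}+1$, and $f_{i-1}+1$.
   Context: Fibonacci words: $F_1=\texttt{b}$, $F_2=\texttt{a}$, $F_k=F_{k-1}F_{k-2}$ for $k\ge 3$; $f_k=|F_k|$. Positions are 1-indexed; $S$ occurs at position $p$ in $T$ if $T[p\ldots p+|S|-1]=S$. -}

module Defs where

open import Data.Nat using (ℕ; zero; suc; _+_)
open import Data.List using (List; []; _∷_; _++_; length)
open import Data.Product using (Σ; _×_; ∃)
open import Relation.Binary.PropositionalEquality using (_≡_)

data Letter : Set where
  a b : Letter

-- Fibonacci words: F 1 = b, F 2 = a, F k = F (k-1) F (k-2) for k ≥ 3.
-- F 0 is an unused placeholder (the paper indexes from 1).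
F : ℕ → List Letter
F zero = []
F (suc zero) = b ∷ []
F (suc (suc zero)) = a ∷ []
F (suc (suc (suc k))) = F (suc (suc k)) ++ F (suc k)

f : ℕ → ℕ
f k = length (F k)

-- S occurs at (1-indexed) position p in T iff T[p .. p+|S|-1] = S,
-- i.e. T = u ++ S ++ v with |u| = p - 1.
OccursAt : List Letter → List Letter → ℕ → Set
OccursAt S T p = Σ (List Letter) λ u → Σ (List Letter) λ v →
  (T ≡ u ++ S ++ v) × (suc (length u) ≡ p)

{-# OPTIONS --safe #-}
module Submission where

-- The Fibonacci morphism φ (a ↦ ab, b ↦ a) maps F k to F (k + 1), and every letter a of
-- a word φ Y begins the image of a letter of Y. So an occurrence of F (k + 1) = φ (F k) in
-- F (k + 4) = φ (F (k + 3)) is the image of an occurrence of F k in F (k + 3), unless F k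
-- ends in b and the final a = φ b is only the first half of an ab = φ a. That cannot happen:
-- F k would then end in aab, putting aaa into F (k + 3), while no word φ (φ Z) contains aaa.
-- Hence φ carries the occurrences of F k in F (k + 3), and the prefixes ε, F k, F (k + 1),
-- F (k + 2) in front of them, bijectively onto the next ones, and the induction starts from
-- the occurrences of F 4 = aba in F 7, found by enumeration.

open import Defs
open import Data.Empty using (⊥-elim)
open import Data.List using (List; []; _∷_; _++_; _∷ʳ_; length; concatMap)
open import Data.List.Properties
  using (concatMap-++; ++-assoc; ∷-injectiveʳ; ∷ʳ-injectiveˡ; ∷ʳ-injectiveʳ)
open import Data.Nat using (ℕ; zero; suc; _+_; _≤_; _∸_; s≤s; z≤n)
open import Data.Product using (∃; ∃₂; _×_; _,_)
open import Data.Sum as Sum using (_⊎_; inj₁; inj₂)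
open import Function.Bundles using (_⇔_; mk⇔)
open import Relation.Binary.PropositionalEquality
  using (_≡_; _≢_; refl; sym; trans; cong; cong₂; module ≡-Reasoning)
open import Relation.Nullary using (contradiction)

σ : Letter → List Letter
σ a = a ∷ b ∷ []
σ b = a ∷ []

φ : List Letter → List Letter
φ = concatMap σ

φ-++ : ∀ xs ys → φ (xs ++ ys) ≡ φ xs ++ φ ys
φ-++ = concatMap-++ σ

φ-F : ∀ k → φ (F (suc k)) ≡ F (suc (suc k))
φ-F zero = refl
φ-F (suc zero) = refl
φ-F (suc (suc k)) =
  trans (φ-++ (F (suc (suc k))) (F (suc k))) (cong₂ _++_ (φ-F (suc k)) (φ-F k))

φ-split : ∀ Y u w → φ Y ≡ u ++ a ∷ w →
          ∃₂ λ Y₁ Y₂ → Y ≡ Y₁ ++ Y₂ × u ≡ φ Y₁ × φ Y₂ ≡ a ∷ w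
φ-split Y [] w eq = [] , Y , refl , refl , eq
φ-split [] (_ ∷ _) w ()
φ-split (b ∷ Y) (b ∷ u) w ()
φ-split (b ∷ Y) (a ∷ u) w eq with φ-split Y u w (∷-injectiveʳ eq)
... | Y₁ , Y₂ , refl , refl , eq₂ = b ∷ Y₁ , Y₂ , refl , refl , eq₂
φ-split (a ∷ Y) (_ ∷ []) w ()
φ-split (a ∷ Y) (b ∷ _ ∷ u) w ()
φ-split (a ∷ Y) (a ∷ a ∷ u) w ()
φ-split (a ∷ Y) (a ∷ b ∷ u) w eq
  with φ-split Y u w (∷-injectiveʳ (∷-injectiveʳ eq))
... | Y₁ , Y₂ , refl , refl , eq₂ = a ∷ Y₁ , Y₂ , refl , refl , eq₂

φ-reflects-prefix : ∀ X Y v → φ Y ≡ φ X ++ v →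
                    (∃ λ v′ → Y ≡ X ++ v′) ⊎
                    (∃₂ λ X′ v′ → X ≡ X′ ∷ʳ b × Y ≡ X′ ++ a ∷ v′)
φ-reflects-prefix [] Y v _ = inj₁ (Y , refl)
φ-reflects-prefix (a ∷ X) [] v ()
φ-reflects-prefix (a ∷ X) (b ∷ []) v ()
φ-reflects-prefix (a ∷ X) (b ∷ a ∷ Y) v ()
φ-reflects-prefix (a ∷ X) (b ∷ b ∷ Y) v ()
φ-reflects-prefix (a ∷ X) (a ∷ Y) v eq
  with φ-reflects-prefix X Y v (∷-injectiveʳ (∷-injectiveʳ eq))
... | inj₁ (v′ , refl) = inj₁ (v′ , refl)
... | inj₂ (X′ , v′ , refl , refl) = inj₂ (a ∷ X′ , v′ , refl , refl)
φ-reflects-prefix (b ∷ X) [] v ()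
φ-reflects-prefix (b ∷ []) (a ∷ Y) v _ = inj₂ ([] , Y , refl , refl)
φ-reflects-prefix (b ∷ a ∷ X) (a ∷ Y) v ()
φ-reflects-prefix (b ∷ b ∷ X) (a ∷ Y) v ()
φ-reflects-prefix (b ∷ X) (b ∷ Y) v eq with φ-reflects-prefix X Y v (∷-injectiveʳ eq)
... | inj₁ (v′ , refl) = inj₁ (v′ , refl)
... | inj₂ (X′ , v′ , refl , refl) = inj₂ (b ∷ X′ , v′ , refl , refl)

φ-bb-free : ∀ Y s t → φ Y ≢ s ++ b ∷ b ∷ t
φ-bb-free [] [] t ()
φ-bb-free [] (_ ∷ _) t ()
φ-bb-free (a ∷ Y) [] t ()
φ-bb-free (a ∷ []) (_ ∷ []) t ()
φ-bb-free (a ∷ a ∷ Y) (_ ∷ []) t ()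
φ-bb-free (a ∷ b ∷ Y) (_ ∷ []) t ()
φ-bb-free (a ∷ Y) (_ ∷ _ ∷ s) t eq = φ-bb-free Y s t (∷-injectiveʳ (∷-injectiveʳ eq))
φ-bb-free (b ∷ Y) [] t ()
φ-bb-free (b ∷ Y) (_ ∷ s) t eq = φ-bb-free Y s t (∷-injectiveʳ eq)

F-aaa-free : ∀ k s t → F (3 + k) ≢ s ++ a ∷ a ∷ a ∷ t
F-aaa-free k s t eq with φ-split (F (2 + k)) s (a ∷ a ∷ t) (trans (φ-F (1 + k)) eq)
... | Y₁ , b ∷ b ∷ Y₂ , F₂₊ₖ≡Y₁bbY₂ , _ , _ =
  φ-bb-free (F (1 + k)) Y₁ Y₂ (trans (φ-F k) F₂₊ₖ≡Y₁bbY₂)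
... | _ , [] , _ , _ , ()
... | _ , a ∷ _ , _ , _ , ()
... | _ , b ∷ [] , _ , _ , ()
... | _ , b ∷ a ∷ _ , _ , _ , ()

F-starts-with-a : ∀ k → ∃ λ w → F (2 + k) ≡ a ∷ w
F-starts-with-a zero = [] , refl
F-starts-with-a (suc k) with F-starts-with-a k
... | w , eq = w ++ F (suc k) , cong (_++ F (suc k)) eq

F-ends-with-aba-or-aab : ∀ m → ∃ λ w →
  F (4 + m) ≡ w ++ a ∷ b ∷ a ∷ [] ⊎ F (4 + m) ≡ w ++ a ∷ a ∷ b ∷ []
F-ends-with-aba-or-aab zero = [] , inj₁ refl
F-ends-with-aba-or-aab (suc zero) = a ∷ b ∷ [] , inj₂ refl
F-ends-with-aba-or-aab (suc (suc m)) with F-ends-with-aba-or-aab m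
... | w , eq = F (5 + m) ++ w , Sum.map prepend prepend eq
  where prepend : ∀ {xs} → F (4 + m) ≡ w ++ xs → F (6 + m) ≡ (F (5 + m) ++ w) ++ xs
        prepend {xs} eq = trans (cong (F (5 + m) ++_) eq) (sym (++-assoc (F (5 + m)) w xs))

F-ending-in-b : ∀ m X → F (4 + m) ≡ X ∷ʳ b → ∃ λ w → X ≡ w ++ a ∷ a ∷ []
F-ending-in-b m X eq with F-ends-with-aba-or-aab m
... | w , inj₁ e =
  contradiction (∷ʳ-injectiveʳ (w ++ a ∷ b ∷ []) X (trans (++-assoc w _ _) (trans (sym e) eq)))
                λ ()
... | w , inj₂ e =
  w , sym (∷ʳ-injectiveˡ (w ++ a ∷ a ∷ []) X (trans (++-assoc w _ _) (trans (sym e) eq)))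

OccursAfter : ℕ → List Letter → Set
OccursAfter m u = ∃ λ v → F (7 + m) ≡ u ++ F (4 + m) ++ v

StandardPrefix : ℕ → List Letter → Set
StandardPrefix m u = u ≡ [] ⊎ u ≡ F (4 + m) ⊎ u ≡ F (5 + m) ⊎ u ≡ F (6 + m)

Position : ℕ → ℕ → Set
Position m p = p ≡ 1 ⊎ p ≡ suc (f (4 + m)) ⊎ p ≡ suc (f (5 + m)) ⊎ p ≡ suc (f (6 + m))

occursAfter-φ⁺ : ∀ m u → OccursAfter m u → OccursAfter (suc m) (φ u)
occursAfter-φ⁺ m u (v , eq) = φ v , (begin
  F (8 + m)                         ≡⟨ sym (φ-F (6 + m)) ⟩
  φ (F (7 + m))                     ≡⟨ cong φ eq ⟩
  φ (u ++ F (4 + m) ++ v)           ≡⟨ φ-++ u _ ⟩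
  φ u ++ φ (F (4 + m) ++ v)         ≡⟨ cong (φ u ++_) (φ-++ (F (4 + m)) v) ⟩
  φ u ++ φ (F (4 + m)) ++ φ v       ≡⟨ cong (λ z → φ u ++ z ++ φ v) (φ-F (3 + m)) ⟩
  φ u ++ F (5 + m) ++ φ v           ∎)
  where open ≡-Reasoning

occursAfter-φ⁻ : ∀ m u → OccursAfter (suc m) u →
                 ∃ λ u₀ → u ≡ φ u₀ × OccursAfter m u₀
occursAfter-φ⁻ m u (v , eq) with F-starts-with-a (3 + m)
... | w , F₅₊ₘ≡aw
  with φ-split (F (7 + m)) u (w ++ v)
         (trans (φ-F (6 + m)) (trans eq (cong (λ z → u ++ z ++ v) F₅₊ₘ≡aw)))
... | Y₁ , Y₂ , F₇₊ₘ≡Y₁Y₂ , refl , φY₂≡awv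
  with φ-reflects-prefix (F (4 + m)) Y₂ v
         (trans φY₂≡awv (cong (_++ v) (trans (sym F₅₊ₘ≡aw) (sym (φ-F (3 + m))))))
... | inj₁ (v′ , refl) = Y₁ , refl , v′ , F₇₊ₘ≡Y₁Y₂
... | inj₂ (X′ , v′ , F₄₊ₘ≡X′b , refl) with F-ending-in-b m X′ F₄₊ₘ≡X′b
... | w′ , refl = ⊥-elim (F-aaa-free (4 + m) (Y₁ ++ w′) v′ F₇₊ₘ≡Y₁w′aaav′)
  where
  F₇₊ₘ≡Y₁w′aaav′ : F (7 + m) ≡ (Y₁ ++ w′) ++ a ∷ a ∷ a ∷ v′
  F₇₊ₘ≡Y₁w′aaav′ =
    trans F₇₊ₘ≡Y₁Y₂ (trans (cong (Y₁ ++_) (++-assoc w′ _ _)) (sym (++-assoc Y₁ w′ _)))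

standardPrefix-φ⁺ : ∀ m u → StandardPrefix m u → StandardPrefix (suc m) (φ u)
standardPrefix-φ⁺ m _ (inj₁ refl) = inj₁ refl
standardPrefix-φ⁺ m _ (inj₂ (inj₁ refl)) = inj₂ (inj₁ (φ-F (3 + m)))
standardPrefix-φ⁺ m _ (inj₂ (inj₂ (inj₁ refl))) = inj₂ (inj₂ (inj₁ (φ-F (4 + m))))
standardPrefix-φ⁺ m _ (inj₂ (inj₂ (inj₂ refl))) = inj₂ (inj₂ (inj₂ (φ-F (5 + m))))

standardPrefix-φ⁻ : ∀ m u → StandardPrefix (suc m) u →
                    ∃ λ u₀ → u ≡ φ u₀ × StandardPrefix m u₀
standardPrefix-φ⁻ m _ (inj₁ refl) = [] , refl , inj₁ refl
standardPrefix-φ⁻ m _ (inj₂ (inj₁ refl)) =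
  F (4 + m) , sym (φ-F (3 + m)) , inj₂ (inj₁ refl)
standardPrefix-φ⁻ m _ (inj₂ (inj₂ (inj₁ refl))) =
  F (5 + m) , sym (φ-F (4 + m)) , inj₂ (inj₂ (inj₁ refl))
standardPrefix-φ⁻ m _ (inj₂ (inj₂ (inj₂ refl))) =
  F (6 + m) , sym (φ-F (5 + m)) , inj₂ (inj₂ (inj₂ refl))

aba-in-F₇ : ∀ u → OccursAfter 0 u → StandardPrefix 0 u
aba-in-F₇ [] _ = inj₁ refl
aba-in-F₇ (_ ∷ []) (_ , ())
aba-in-F₇ (_ ∷ _ ∷ []) (_ , ())
aba-in-F₇ (_ ∷ _ ∷ _ ∷ []) (_ , refl) = inj₂ (inj₁ refl)
aba-in-F₇ (_ ∷ _ ∷ _ ∷ _ ∷ []) (_ , ())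
aba-in-F₇ (_ ∷ _ ∷ _ ∷ _ ∷ _ ∷ []) (_ , refl) = inj₂ (inj₂ (inj₁ refl))
aba-in-F₇ (_ ∷ _ ∷ _ ∷ _ ∷ _ ∷ _ ∷ []) (_ , ())
aba-in-F₇ (_ ∷ _ ∷ _ ∷ _ ∷ _ ∷ _ ∷ _ ∷ []) (_ , ())
aba-in-F₇ (_ ∷ _ ∷ _ ∷ _ ∷ _ ∷ _ ∷ _ ∷ _ ∷ []) (_ , refl) = inj₂ (inj₂ (inj₂ refl))
aba-in-F₇ (_ ∷ _ ∷ _ ∷ _ ∷ _ ∷ _ ∷ _ ∷ _ ∷ _ ∷ []) (_ , ())
aba-in-F₇ (_ ∷ _ ∷ _ ∷ _ ∷ _ ∷ _ ∷ _ ∷ _ ∷ _ ∷ _ ∷ []) (_ , ())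
aba-in-F₇ (_ ∷ _ ∷ _ ∷ _ ∷ _ ∷ _ ∷ _ ∷ _ ∷ _ ∷ _ ∷ _ ∷ []) (_ , ())
aba-in-F₇ (_ ∷ _ ∷ _ ∷ _ ∷ _ ∷ _ ∷ _ ∷ _ ∷ _ ∷ _ ∷ _ ∷ _ ∷ []) (_ , ())
aba-in-F₇ (_ ∷ _ ∷ _ ∷ _ ∷ _ ∷ _ ∷ _ ∷ _ ∷ _ ∷ _ ∷ _ ∷ _ ∷ _ ∷ []) (_ , ())
aba-in-F₇ (_ ∷ _ ∷ _ ∷ _ ∷ _ ∷ _ ∷ _ ∷ _ ∷ _ ∷ _ ∷ _ ∷ _ ∷ _ ∷ _ ∷ _) (_ , ())

occursAfter⇒standardPrefix : ∀ m u → OccursAfter m u → StandardPrefix m u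
occursAfter⇒standardPrefix zero = aba-in-F₇
occursAfter⇒standardPrefix (suc m) u occ with occursAfter-φ⁻ m u occ
... | u₀ , refl , occ₀ = standardPrefix-φ⁺ m u₀ (occursAfter⇒standardPrefix m u₀ occ₀)

standardPrefix⇒occursAfter : ∀ m u → StandardPrefix m u → OccursAfter m u
standardPrefix⇒occursAfter zero _ (inj₁ refl) = _ , refl
standardPrefix⇒occursAfter zero _ (inj₂ (inj₁ refl)) = _ , refl
standardPrefix⇒occursAfter zero _ (inj₂ (inj₂ (inj₁ refl))) = _ , refl
standardPrefix⇒occursAfter zero _ (inj₂ (inj₂ (inj₂ refl))) = _ , refl
standardPrefix⇒occursAfter (suc m) u std with standardPrefix-φ⁻ m u std
... | u₀ , refl , std₀ = occursAfter-φ⁺ m u₀ (standardPrefix⇒occursAfter m u₀ std₀)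

standardPrefix⇒position : ∀ m u p → suc (length u) ≡ p → StandardPrefix m u → Position m p
standardPrefix⇒position m _ _ refl (inj₁ refl) = inj₁ refl
standardPrefix⇒position m _ _ refl (inj₂ (inj₁ refl)) = inj₂ (inj₁ refl)
standardPrefix⇒position m _ _ refl (inj₂ (inj₂ (inj₁ refl))) = inj₂ (inj₂ (inj₁ refl))
standardPrefix⇒position m _ _ refl (inj₂ (inj₂ (inj₂ refl))) = inj₂ (inj₂ (inj₂ refl))

position⇒standardPrefix : ∀ m p → Position m p →
                          ∃ λ u → StandardPrefix m u × suc (length u) ≡ p
position⇒standardPrefix m _ (inj₁ refl) = [] , inj₁ refl , refl
position⇒standardPrefix m _ (inj₂ (inj₁ refl)) = F (4 + m) , inj₂ (inj₁ refl) , refl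
position⇒standardPrefix m _ (inj₂ (inj₂ (inj₁ refl))) =
  F (5 + m) , inj₂ (inj₂ (inj₁ refl)) , refl
position⇒standardPrefix m _ (inj₂ (inj₂ (inj₂ refl))) =
  F (6 + m) , inj₂ (inj₂ (inj₂ refl)) , refl

lemma15 : (i : ℕ) → 7 ≤ i → (p : ℕ) →
    OccursAt (F (i ∸ 3)) (F i) p ⇔
      (p ≡ 1 ⊎ p ≡ suc (f (i ∸ 3)) ⊎ p ≡ suc (f (i ∸ 2)) ⊎ p ≡ suc (f (i ∸ 1)))
lemma15 (suc (suc (suc (suc (suc (suc (suc m))))))) (s≤s (s≤s (s≤s (s≤s (s≤s (s≤s (s≤s z≤n))))))) p =
  mk⇔ (λ (u , v , eq , at-p) →
         standardPrefix⇒position m u p at-p (occursAfter⇒standardPrefix m u (v , eq)))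
      (λ at-p → let (u , std , at-p′) = position⇒standardPrefix m p at-p
                    (v , eq) = standardPrefix⇒occursAfter m u std
                in u , v , eq , at-p′)
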